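{- Let $q$ be a prime power, $d\ge2$, let $\Lambda=g\mathcal R^d$ be a lattice with $\mathcal D_\Lambda=g\mathfrak m^d$, let $N\in\mathbb{N}$, and let $\alpha\in\mathcal K_\infty^d$ be $N$-irrational with respect to $\Lambda$. Then $\#(\mathcal{D}_\Lambda\cap\Lambda(\alpha,q^N))=q^{N+1}$. As a consequence, $\Lambda(\alpha,q^N)$ is a $(\Lambda,q^{N+1})$-periodic lattice.
   Context: $\mathcal{R}=\mathbb{F}_q[x]$, $\mathcal R_{\le N}=\{Q\in\mathcal R:\deg Q\le N\}$, $\mathcal{K}_\infty=\mathbb{F}_q((x^{ -1}))$, $\mathcal{O}=\mathbb{F}_q[[x^{ -1}]]$, $\mathfrak{m}=x^{ -1}\mathcal{O}$. A lattice is $\Lambda=g\mathcal R^d$ with $g\in\operatorname{GL}_d(\mathcal K_\infty)$. $\alpha$ is $N$-irrational with respect to $\Lambda$ if there is no $Q\in\mathcal R_{\le N}\setminus\{0\}$ with $Q\alpha\in\Lambda$. $\Lambda(\alpha,q^N)=\bigcup_{Q\in\mathcal R_{\le N}}(Q\alpha+\Lambda)$. A $(\Lambda,q^M)$-periodic lattice is an $\mathbb{F}_q$-subspace $S\subseteq\mathcal K_\infty^d$ with $\Lambda+S=S$ and $\#(\mathcal D_\Lambda\cap S)=q^M$. -}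

module Defs where

open import Level using (0ℓ)
open import Algebra.Bundles using (CommutativeRing)
open import Data.Nat using (ℕ; zero; suc) renaming (_+_ to _+ℕ_; _∸_ to _∸ℕ_)
open import Data.Integer using (ℤ; +_; -[1+_]) renaming (_-_ to _-ℤ_; _+_ to _+ℤ_; _<_ to _<ℤ_; _≤_ to _≤ℤ_)
open import Data.Integer.Base using (_⊔_)
open import Data.Fin using (Fin; _≟_)
open import Data.Product using (Σ; _×_; _,_)
open import Relation.Nullary using (¬_)
open import Relation.Binary.PropositionalEquality using (_≡_)

-- A finite field with exactly q elements (q is then automatically a
-- prime power).  Equality is the setoid equality _≈_ of the ring.

record FiniteField (q : ℕ) : Set₁ where
  field
    commRing : CommutativeRing 0ℓ 0ℓ
  open CommutativeRing commRing public
  field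
    1≉0      : ¬ (1# ≈ 0#)
    inverse  : ∀ x → ¬ (x ≈ 0#) → Σ Carrier (λ y → x * y ≈ 1#)
    enum     : Fin q → Carrier
    enum-inj : ∀ i j → enum i ≈ enum j → i ≡ j
    enum-sur : ∀ x → Σ (Fin q) (λ i → x ≈ enum i)

-- Laurent series in x⁻¹ over F, i.e. elements of K∞ = F((x⁻¹)).
-- A series is  Σ_{n ≥ 0} s n · x^(e - n)  (e : ℤ, s : ℕ → F).

module LaurentOver {q : ℕ} (F : FiniteField q) where
  open FiniteField F

  record K∞ : Set where
    constructor mkK
    field
      top : ℤ
      ser : ℕ → Carrier
  open K∞ public

  coeff : K∞ → ℤ → Carrier
  coeff a k with top a -ℤ k
  ... | + n      = ser a n
  ... | -[1+ _ ] = 0#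

  _≈K_ : K∞ → K∞ → Set
  a ≈K b = ∀ k → coeff a k ≈ coeff b k

  0K : K∞
  0K = mkK (+ 0) (λ _ → 0#)

  const : Carrier → K∞
  const c = mkK (+ 0) (λ { zero → c ; (suc _) → 0# })

  _+K_ : K∞ → K∞ → K∞
  a +K b = mkK e (λ n → coeff a (e -ℤ + n) + coeff b (e -ℤ + n))
    where e = top a ⊔ top b

  negK : K∞ → K∞
  negK a = mkK (top a) (λ n → - ser a n)

  conv : (ℕ → Carrier) → (ℕ → Carrier) → ℕ → ℕ → Carrier
  conv s t n zero    = s 0 * t n
  conv s t n (suc i) = s (suc i) * t (n ∸ℕ suc i) + conv s t n i

  _*K_ : K∞ → K∞ → K∞
  a *K b = mkK (top a +ℤ top b) (λ n → conv (ser a) (ser b) n n)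

  -- R = F[x] inside K∞, R_{≤N}, and 𝔪 = x⁻¹ F[[x⁻¹]]
  IsPoly : K∞ → Set
  IsPoly a = ∀ k → k <ℤ + 0 → coeff a k ≈ 0#

  DegLe : ℕ → K∞ → Set
  DegLe N a = ∀ k → + N <ℤ k → coeff a k ≈ 0#

  InM : K∞ → Set
  InM a = ∀ k → + 0 ≤ℤ k → coeff a k ≈ 0#

  Vec : ℕ → Set
  Vec d = Fin d → K∞

  Mat : ℕ → Set
  Mat d = Fin d → Fin d → K∞

  _≈V_ : ∀ {d} → Vec d → Vec d → Set
  u ≈V v = ∀ i → u i ≈K v i

  sumK : ∀ {d} → (Fin d → K∞) → K∞
  sumK {zero}  f = 0K
  sumK {suc d} f = f Fin.zero +K sumK (λ i → f (Fin.suc i))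

  _·_ : ∀ {d} → Mat d → Vec d → Vec d
  (g · v) i = sumK (λ j → g i j *K v j)

  _⊗_ : ∀ {d} → Mat d → Mat d → Mat d
  (g ⊗ h) i k = sumK (λ j → g i j *K h j k)

  idMat : ∀ {d} → Mat d
  idMat i j with i ≟ j
  ... | Relation.Nullary.yes _ = const 1#
  ... | Relation.Nullary.no _  = 0K

  _≈M_ : ∀ {d} → Mat d → Mat d → Set
  g ≈M h = ∀ i j → g i j ≈K h i j

  _+V_ : ∀ {d} → Vec d → Vec d → Vec d
  (u +V v) i = u i +K v i

  _*V_ : ∀ {d} → K∞ → Vec d → Vec d
  (c *V v) i = c *K v i

  0V : ∀ {d} → Vec d
  0V i = 0K

  IsInvertible : ∀ {d} → Mat d → Set
  IsInvertible {d} g = Σ (Mat d) (λ h → ((g ⊗ h) ≈M idMat) × ((h ⊗ g) ≈M idMat))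

  Subset : ℕ → Set₁
  Subset d = Vec d → Set

  InLattice : ∀ {d} → Mat d → Subset d
  InLattice {d} g v = Σ (Vec d) (λ P → (∀ i → IsPoly (P i)) × (v ≈V (g · P)))

  InD : ∀ {d} → Mat d → Subset d
  InD {d} g v = Σ (Vec d) (λ P → (∀ i → InM (P i)) × (v ≈V (g · P)))

  InLatticeAlpha : ∀ {d} → Mat d → Vec d → ℕ → Subset d
  InLatticeAlpha {d} g α N v =
    Σ K∞ (λ Q → IsPoly Q × DegLe N Q ×
      Σ (Vec d) (λ l → InLattice g l × (v ≈V ((Q *V α) +V l))))

  NIrrational : ∀ {d} → Mat d → ℕ → Vec d → Set
  NIrrational g N α =
    ¬ Σ K∞ (λ Q → IsPoly Q × DegLe N Q × ¬ (Q ≈K 0K) × InLattice g (Q *V α))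

  -- # P = n  (for ≈V-closed predicates): a bijection Fin n ≅ P modulo ≈V
  HasCard : ∀ {d} → Subset d → ℕ → Set
  HasCard {d} P n =
    Σ (Fin n → Vec d) (λ f →
      (∀ i → P (f i)) ×
      (∀ i j → f i ≈V f j → i ≡ j) ×
      (∀ v → P v → Σ (Fin n) (λ i → v ≈V f i)))

  _∩_ : ∀ {d} → Subset d → Subset d → Subset d
  (A ∩ B) v = A v × B v

  IsFqSubspace : ∀ {d} → Subset d → Set
  IsFqSubspace S =
    S 0V ×
    (∀ u v → S u → S v → S (u +V v)) ×
    (∀ c v → S v → S (const c *V v))

  LatticePlusEq : ∀ {d} → Mat d → Subset d → Set
  LatticePlusEq {d} g S =
    ∀ v → (Σ (Vec d) (λ l → Σ (Vec d) (λ s → InLattice g l × S s × (v ≈V (l +V s)))) → S v)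
        × (S v → Σ (Vec d) (λ l → Σ (Vec d) (λ s → InLattice g l × S s × (v ≈V (l +V s)))))

  IsPeriodicLattice : ∀ {d} → Mat d → ℕ → Subset d → Set
  IsPeriodicLattice g M S =
    IsFqSubspace S × LatticePlusEq g S × HasCard (InD g ∩ S) (q ^ M)
    where open import Data.Nat using (_^_)

-- Since K∞ = R ⊕ 𝔪, every v ∈ K∞^d splits uniquely as v = w + l with w ∈ 𝒟_Λ = g𝔪^d and
-- l ∈ Λ = gR^d, namely w = g · fracPart (g⁻¹ v). So 𝒟_Λ ∩ Λ(α,q^N) consists of the
-- representatives w_Q of the cosets Qα + Λ, Q ∈ R_{≤N}, and w_Q = w_Q′ would put (Q − Q′)α
-- in Λ, which N-irrationality rules out for Q ≠ Q′; hence the intersection has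
-- #R_{≤N} = q^(N+1) elements.
module Submission where

open import Level using (Level; 0ℓ)
open import Relation.Binary.Bundles using (Setoid)
import Relation.Binary.Reasoning.Setoid as SetoidReasoning
open import Algebra.Bundles using (AbelianGroup; CommutativeRing)
import Data.Fin as Fin
open import Data.Fin using (Fin)
open import Function using (_∘_)
open import Data.Nat as ℕ using (ℕ; zero; suc)
open import Data.Integer using (ℤ; +_; -[1+_]; 0ℤ; +<+; -<+; +≤+)
  renaming (_+_ to _+ℤ_; _-_ to _-ℤ_; _<_ to _<ℤ_; _≤_ to _≤ℤ_; _⊔_ to _⊔ℤ_; -_ to -ℤ_)
import Data.Integer.Properties as ℤ
open import Data.Product using (Σ; _,_; proj₁; proj₂; _×_)
open import Relation.Binary.PropositionalEquality as ≡ using (_≡_)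

open import Defs

funToFin-cong : ∀ {m n} {f g : Fin m → Fin n} → (∀ i → f i ≡ g i) → Fin.funToFin f ≡ Fin.funToFin g
funToFin-cong {zero}  f≗g = ≡.refl
funToFin-cong {suc m} f≗g = ≡.cong₂ Fin.combine (f≗g Fin.zero) (funToFin-cong (f≗g ∘ Fin.suc))

module IntegerLemmas where
  open import Data.Integer
  open import Data.Integer.Properties
  open import Data.Integer.Tactic.RingSolver using (solve-∀)

  i-[i-j]≡j : ∀ i j → i - (i - j) ≡ j
  i-[i-j]≡j = solve-∀

  [i-j]+j≡i : ∀ i j → (i - j) + j ≡ i
  [i-j]+j≡i = solve-∀

  i<j⇒i-j<0 : ∀ {i j} → i < j → i - j < 0ℤ
  i<j⇒i-j<0 {i} {j} i<j = ≡.subst (i - j <_) (+-inverseʳ j) (+-monoˡ-< (- j) i<j)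

  i-j<0⇒i<j : ∀ {i j} → i - j < 0ℤ → i < j
  i-j<0⇒i<j {i} {j} i-j<0 = ≡.subst₂ _<_ ([i-j]+j≡i i j) (+-identityˡ j) (+-monoˡ-< j i-j<0)

  i≤j⇒j≡+n+i : ∀ {i j} → i ≤ j → Σ ℕ λ n → j ≡ + n + i
  i≤j⇒j≡+n+i {i} {j} i≤j = ∣ j - i ∣ , ≡.sym (begin
    + ∣ j - i ∣ + i ≡⟨ ≡.cong (_+ i) (0≤i⇒+∣i∣≡i (i≤j⇒0≤j-i i≤j)) ⟩
    (j - i) + i     ≡⟨ [i-j]+j≡i j i ⟩
    j               ∎)
    where open ≡.≡-Reasoning

module AbelianGroupLemmas {a ℓ : Level} (G : AbelianGroup a ℓ) where
  open AbelianGroup G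
  open import Algebra.Properties.Group group using (//-rightDividesʳ)
  open import Algebra.Properties.AbelianGroup G using (⁻¹-∙-comm)
  open import Algebra.Properties.CommutativeSemigroup commutativeSemigroup using (interchange)
  open import Relation.Binary.Reasoning.Setoid setoid

  x≈y∙z⇒x∙z⁻¹≈y : ∀ x y z → x ≈ y ∙ z → x ∙ z ⁻¹ ≈ y
  x≈y∙z⇒x∙z⁻¹≈y x y z x≈yz = trans (∙-congʳ x≈yz) (//-rightDividesʳ z y)

  zx∙[zy]⁻¹≈x∙y⁻¹ : ∀ x y z → (z ∙ x) ∙ (z ∙ y) ⁻¹ ≈ x ∙ y ⁻¹
  zx∙[zy]⁻¹≈x∙y⁻¹ x y z = begin
    (z ∙ x) ∙ (z ∙ y) ⁻¹       ≈⟨ ∙-congˡ (⁻¹-∙-comm z y) ⟨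
    (z ∙ x) ∙ (z ⁻¹ ∙ y ⁻¹)    ≈⟨ interchange z x (z ⁻¹) (y ⁻¹) ⟩
    (z ∙ z ⁻¹) ∙ (x ∙ y ⁻¹)    ≈⟨ ∙-congʳ (inverseʳ z) ⟩
    ε ∙ (x ∙ y ⁻¹)             ≈⟨ identityˡ _ ⟩
    x ∙ y ⁻¹                   ∎

module PowerSeries {c ℓ : Level} (R : CommutativeRing c ℓ) where
  open CommutativeRing R
  open import Algebra.Properties.CommutativeSemigroup +-commutativeSemigroup
    using (interchange; x∙yz≈y∙xz)
  open import Relation.Binary.Reasoning.Setoid setoid

  Series : Set c
  Series = ℕ → Carrier

  infix  4 _≈ₛ_
  infixl 6 _+ₛ_
  infixl 7 _*ₛ_ _·ₛ_

  _≈ₛ_ : Series → Series → Set ℓ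
  s ≈ₛ t = ∀ n → s n ≈ t n

  tailₛ : Series → Series
  tailₛ s n = s (suc n)

  _+ₛ_ : Series → Series → Series
  (s +ₛ t) n = s n + t n

  _·ₛ_ : Carrier → Series → Series
  (a ·ₛ s) n = a * s n

  0ₛ : Series
  0ₛ _ = 0#

  constₛ : Carrier → Series
  constₛ a zero    = a
  constₛ a (suc _) = 0#

  _*ₛ_ : Series → Series → Series
  (s *ₛ t) zero    = s 0 * t 0
  (s *ₛ t) (suc n) = s 0 * t (suc n) + (tailₛ s *ₛ t) n

  *ₛ-cong : ∀ {s s′ t t′} → s ≈ₛ s′ → t ≈ₛ t′ → s *ₛ t ≈ₛ s′ *ₛ t′
  *ₛ-cong s≈s′ t≈t′ zero    = *-cong (s≈s′ 0) (t≈t′ 0)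
  *ₛ-cong s≈s′ t≈t′ (suc n) =
    +-cong (*-cong (s≈s′ 0) (t≈t′ (suc n))) (*ₛ-cong (λ k → s≈s′ (suc k)) t≈t′ n)

  0ₛ-*ₛ : ∀ t → 0ₛ *ₛ t ≈ₛ 0ₛ
  0ₛ-*ₛ t zero    = zeroˡ (t 0)
  0ₛ-*ₛ t (suc n) = trans (+-cong (zeroˡ _) (0ₛ-*ₛ t n)) (+-identityˡ 0#)

  constₛ-*ₛ : ∀ a t → constₛ a *ₛ t ≈ₛ a ·ₛ t
  constₛ-*ₛ a t zero    = refl
  constₛ-*ₛ a t (suc n) = trans (+-congˡ (0ₛ-*ₛ t n)) (+-identityʳ _)

  *ₛ-comm : ∀ s t → s *ₛ t ≈ₛ t *ₛ s
  *ₛ-comm s t zero          = *-comm (s 0) (t 0)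
  *ₛ-comm s t (suc zero)    = begin
    s 0 * t 1 + s 1 * t 0 ≈⟨ +-comm _ _ ⟩
    s 1 * t 0 + s 0 * t 1 ≈⟨ +-cong (*-comm _ _) (*-comm _ _) ⟩
    t 0 * s 1 + t 1 * s 0 ∎
  *ₛ-comm s t (suc (suc n)) = begin
    s 0 * t (2 ℕ.+ n) + (tailₛ s *ₛ t) (suc n)
      ≈⟨ +-congˡ (*ₛ-comm (tailₛ s) t (suc n)) ⟩
    s 0 * t (2 ℕ.+ n) + (t 0 * s (2 ℕ.+ n) + (tailₛ t *ₛ tailₛ s) n)
      ≈⟨ x∙yz≈y∙xz _ _ _ ⟩
    t 0 * s (2 ℕ.+ n) + (s 0 * t (2 ℕ.+ n) + (tailₛ t *ₛ tailₛ s) n)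
      ≈⟨ +-congˡ (+-congˡ (*ₛ-comm (tailₛ t) (tailₛ s) n)) ⟩
    t 0 * s (2 ℕ.+ n) + (s 0 * t (2 ℕ.+ n) + (tailₛ s *ₛ tailₛ t) n)
      ≈⟨ +-congˡ (*ₛ-comm s (tailₛ t) (suc n)) ⟩
    t 0 * s (2 ℕ.+ n) + (tailₛ t *ₛ s) (suc n) ∎

  *ₛ-distribʳ : ∀ s s′ t → (s +ₛ s′) *ₛ t ≈ₛ s *ₛ t +ₛ s′ *ₛ t
  *ₛ-distribʳ s s′ t zero    = distribʳ _ _ _
  *ₛ-distribʳ s s′ t (suc n) = begin
    (s 0 + s′ 0) * t (suc n) + ((tailₛ s +ₛ tailₛ s′) *ₛ t) n
      ≈⟨ +-cong (distribʳ _ _ _) (*ₛ-distribʳ (tailₛ s) (tailₛ s′) t n) ⟩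
    (s 0 * t (suc n) + s′ 0 * t (suc n)) + ((tailₛ s *ₛ t) n + (tailₛ s′ *ₛ t) n)
      ≈⟨ interchange _ _ _ _ ⟩
    (s *ₛ t +ₛ s′ *ₛ t) (suc n) ∎

  *ₛ-distribˡ : ∀ s t t′ → s *ₛ (t +ₛ t′) ≈ₛ s *ₛ t +ₛ s *ₛ t′
  *ₛ-distribˡ s t t′ n = begin
    (s *ₛ (t +ₛ t′)) n        ≈⟨ *ₛ-comm s (t +ₛ t′) n ⟩
    ((t +ₛ t′) *ₛ s) n        ≈⟨ *ₛ-distribʳ t t′ s n ⟩
    (t *ₛ s +ₛ t′ *ₛ s) n     ≈⟨ +-cong (*ₛ-comm t s n) (*ₛ-comm t′ s n) ⟩
    (s *ₛ t +ₛ s *ₛ t′) n     ∎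

  ·ₛ-*ₛ : ∀ a s t → (a ·ₛ s) *ₛ t ≈ₛ a ·ₛ (s *ₛ t)
  ·ₛ-*ₛ a s t zero    = *-assoc _ _ _
  ·ₛ-*ₛ a s t (suc n) = trans (+-cong (*-assoc _ _ _) (·ₛ-*ₛ a (tailₛ s) t n)) (sym (distribˡ _ _ _))

  *ₛ-assoc : ∀ s t u → (s *ₛ t) *ₛ u ≈ₛ s *ₛ (t *ₛ u)
  *ₛ-assoc s t u zero    = *-assoc _ _ _
  *ₛ-assoc s t u (suc n) = begin
    (s 0 * t 0) * u (suc n) + ((s 0 ·ₛ tailₛ t +ₛ tailₛ s *ₛ t) *ₛ u) n
      ≈⟨ +-congˡ (*ₛ-distribʳ _ _ u n) ⟩
    (s 0 * t 0) * u (suc n) + (((s 0 ·ₛ tailₛ t) *ₛ u) n + ((tailₛ s *ₛ t) *ₛ u) n)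
      ≈⟨ +-congˡ (+-cong (·ₛ-*ₛ (s 0) (tailₛ t) u n) (*ₛ-assoc (tailₛ s) t u n)) ⟩
    (s 0 * t 0) * u (suc n) + (s 0 * (tailₛ t *ₛ u) n + (tailₛ s *ₛ (t *ₛ u)) n)
      ≈⟨ sym (+-assoc _ _ _) ⟩
    ((s 0 * t 0) * u (suc n) + s 0 * (tailₛ t *ₛ u) n) + (tailₛ s *ₛ (t *ₛ u)) n
      ≈⟨ +-congʳ (trans (+-congʳ (*-assoc _ _ _)) (sym (distribˡ _ _ _))) ⟩
    s 0 * (t *ₛ u) (suc n) + (tailₛ s *ₛ (t *ₛ u)) n ∎

  shift : ℕ → Series → Series
  shift zero    s         = s
  shift (suc m) s zero    = 0#
  shift (suc m) s (suc n) = shift m s n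

  shift-< : ∀ m s {n} → n ℕ.< m → shift m s n ≈ 0#
  shift-< (suc m) s {zero}  _               = refl
  shift-< (suc m) s {suc n} (ℕ.s≤s n<m) = shift-< m s n<m

  shift-+ : ∀ m s n → shift m s (m ℕ.+ n) ≡ s n
  shift-+ zero    s n = ≡.refl
  shift-+ (suc m) s n = shift-+ m s n

  shift-*ₛ : ∀ m s t → shift m s *ₛ t ≈ₛ shift m (s *ₛ t)
  shift-*ₛ zero    s t n       = refl
  shift-*ₛ (suc m) s t zero    = zeroˡ (t 0)
  shift-*ₛ (suc m) s t (suc n) =
    trans (+-cong (zeroˡ _) (shift-*ₛ m s t n)) (+-identityˡ _)

  padded : ∀ {n} → (Fin n → Carrier) → Series
  padded {zero}  c _       = 0#
  padded {suc n} c zero    = c Fin.zero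
  padded {suc n} c (suc m) = padded (c ∘ Fin.suc) m

  padded-≥ : ∀ {n} c {m} → n ℕ.≤ m → padded {n} c m ≈ 0#
  padded-≥ {zero}  c         _             = refl
  padded-≥ {suc n} c {suc m} (ℕ.s≤s n≤m) = padded-≥ (c ∘ Fin.suc) n≤m

  padded-toℕ : ∀ {n} c (i : Fin n) → padded c (Fin.toℕ i) ≡ c i
  padded-toℕ c Fin.zero    = ≡.refl
  padded-toℕ c (Fin.suc i) = padded-toℕ (c ∘ Fin.suc) i

  padded-cong : ∀ {n} {c c′ : Fin n → Carrier} → (∀ i → c i ≈ c′ i) → padded c ≈ₛ padded c′
  padded-cong {zero}  c≈c′ _       = refl
  padded-cong {suc n} c≈c′ zero    = c≈c′ Fin.zero
  padded-cong {suc n} c≈c′ (suc m) = padded-cong (c≈c′ ∘ Fin.suc) m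

  padded-restrict : ∀ n s → (∀ m → n ℕ.≤ m → s m ≈ 0#) → s ≈ₛ padded {n} (s ∘ Fin.toℕ)
  padded-restrict zero    s s₀ m       = s₀ m ℕ.z≤n
  padded-restrict (suc n) s s₀ zero    = refl
  padded-restrict (suc n) s s₀ (suc m) = padded-restrict n (tailₛ s) (λ k n≤k → s₀ (suc k) (ℕ.s≤s n≤k)) m

module LaurentSeriesRing {q : ℕ} (F : FiniteField q) where
  open FiniteField F
  open LaurentOver F
  open PowerSeries commRing
  open IntegerLemmas
  open import Algebra.Properties.Ring ring using (-0#≈0#)
  open import Algebra.Properties.CommutativeSemigroup +-commutativeSemigroup using (x∙yz≈y∙xz)
  open import Data.Sum using (inj₁; inj₂)

  at : ℤ → Series → Carrier
  at (+ n)    s = s n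
  at -[1+ _ ] s = 0#

  coeff≡at : ∀ a k → coeff a k ≡ at (top a -ℤ k) (ser a)
  coeff≡at a k with top a -ℤ k
  ... | + _      = ≡.refl
  ... | -[1+ _ ] = ≡.refl

  coeff-mkK : ∀ e s k → coeff (mkK e s) k ≈ at (e -ℤ k) s
  coeff-mkK e s k = reflexive (coeff≡at (mkK e s) k)

  at-cong : ∀ i {s t} → s ≈ₛ t → at i s ≈ at i t
  at-cong (+ n)    s≈t = s≈t n
  at-cong -[1+ _ ] s≈t = refl

  at-+ₛ : ∀ i s t → at i (s +ₛ t) ≈ at i s + at i t
  at-+ₛ (+ n)    s t = refl
  at-+ₛ -[1+ _ ] s t = sym (+-identityˡ 0#)

  at-·ₛ : ∀ i a s → at i (a ·ₛ s) ≈ a * at i s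
  at-·ₛ (+ n)    a s = refl
  at-·ₛ -[1+ _ ] a s = sym (zeroʳ a)

  at-neg : ∀ i s → at i (λ n → - s n) ≈ - at i s
  at-neg (+ n)    s = refl
  at-neg -[1+ _ ] s = sym -0#≈0#

  at-0ₛ : ∀ i → at i 0ₛ ≈ 0#
  at-0ₛ (+ n)    = refl
  at-0ₛ -[1+ _ ] = refl

  at-<0 : ∀ {i} s → i <ℤ 0ℤ → at i s ≈ 0#
  at-<0 {+ _}      s (+<+ ())
  at-<0 { -[1+ _ ]} s _ = refl

  at-shift : ∀ m i s → at (+ m +ℤ i) (shift m s) ≈ at i s
  at-shift m (+ n) s = reflexive (shift-+ m s n)
  at-shift m -[1+ n ] s with + m +ℤ -[1+ n ] in eq
  ... | + r      = shift-< m s (ℤ.drop‿+<+ (≡.subst (_<ℤ + m) eq (ℤ.m⊖1+n<m m (suc n))))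
  ... | -[1+ _ ] = refl

  -- ≈K wrapped in a record, so that both sides can be inferred from a proof
  record _≋_ (a b : K∞) : Set where
    constructor mk≋
    field coeff≈ : a ≈K b
  open _≋_ public

  infix 4 _≋_

  ≋-setoid : Setoid 0ℓ 0ℓ
  ≋-setoid = record
    { Carrier = K∞
    ; _≈_ = _≋_
    ; isEquivalence = record
      { refl  = mk≋ λ k → refl
      ; sym   = λ a≋b → mk≋ λ k → sym (coeff≈ a≋b k)
      ; trans = λ a≋b b≋c → mk≋ λ k → trans (coeff≈ a≋b k) (coeff≈ b≋c k)
      }
    }

  open Setoid ≋-setoid public using () renaming (sym to ≋-sym; trans to ≋-trans)
  module ≈-Reasoning = SetoidReasoning setoid
  module ≋-Reasoning = SetoidReasoning ≋-setoid

  mkK-cong : ∀ {e e′ s t} → e ≡ e′ → s ≈ₛ t → mkK e s ≋ mkK e′ t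
  mkK-cong {e} {s = s} {t} ≡.refl s≈t = mk≋ λ k → begin
    coeff (mkK e s) k  ≈⟨ coeff-mkK e s k ⟩
    at (e -ℤ k) s      ≈⟨ at-cong (e -ℤ k) s≈t ⟩
    at (e -ℤ k) t      ≈⟨ coeff-mkK e t k ⟨
    coeff (mkK e t) k  ∎
    where open ≈-Reasoning

  coeff-top : ∀ a n → coeff a (top a -ℤ + n) ≈ ser a n
  coeff-top a n = reflexive (≡.trans (coeff≡at a _) (≡.cong (λ i → at i (ser a)) (i-[i-j]≡j (top a) (+ n))))

  ser-unique : ∀ {a b} → top a ≡ top b → a ≋ b → ser a ≈ₛ ser b
  ser-unique {a} {b} top≡ a≋b n = begin
    ser a n                  ≈⟨ coeff-top a n ⟨
    coeff a (top a -ℤ + n)   ≈⟨ coeff≈ a≋b _ ⟩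
    coeff b (top a -ℤ + n)   ≡⟨ ≡.cong (λ e → coeff b (e -ℤ + n)) top≡ ⟩
    coeff b (top b -ℤ + n)   ≈⟨ coeff-top b n ⟩
    ser b n                  ∎
    where open ≈-Reasoning

  VanishesOn : (ℤ → Set) → K∞ → Set
  VanishesOn Z a = ∀ k → Z k → coeff a k ≈ 0#

  vanishes-above-top : ∀ a → VanishesOn (top a <ℤ_) a
  vanishes-above-top a k top<k = trans (reflexive (coeff≡at a k)) (at-<0 (ser a) (i<j⇒i-j<0 top<k))

  vanishes-above : ∀ {T} a → top a ≤ℤ T → VanishesOn (T <ℤ_) a
  vanishes-above a top≤T k T<k = vanishes-above-top a k (ℤ.≤-<-trans top≤T T<k)

  -- a +K b is defined as mkK e (coeffsFrom e a +ₛ coeffsFrom e b) with e = top a ⊔ top b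
  coeffsFrom : ℤ → K∞ → Series
  coeffsFrom T a n = coeff a (T -ℤ + n)

  at-coeffsFrom : ∀ {T} a → VanishesOn (T <ℤ_) a → ∀ k → at (T -ℤ k) (coeffsFrom T a) ≈ coeff a k
  at-coeffsFrom {T} a vanishes k with T -ℤ k in eq
  ... | + n      = reflexive (≡.cong (coeff a) (≡.subst (λ i → T -ℤ i ≡ k) eq (i-[i-j]≡j T k)))
  ... | -[1+ _ ] = sym (vanishes k (i-j<0⇒i<j (≡.subst (_<ℤ 0ℤ) (≡.sym eq) -<+)))

  mkK-coeffsFrom : ∀ {T} a → VanishesOn (T <ℤ_) a → mkK T (coeffsFrom T a) ≋ a
  mkK-coeffsFrom {T} a vanishes = mk≋ λ k →
    trans (coeff-mkK T _ k) (at-coeffsFrom a vanishes k)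

  coeff-+K : ∀ a b k → coeff (a +K b) k ≈ coeff a k + coeff b k
  coeff-+K a b k = begin
    coeff (a +K b) k                                        ≈⟨ coeff-mkK e _ k ⟩
    at (e -ℤ k) (coeffsFrom e a +ₛ coeffsFrom e b)          ≈⟨ at-+ₛ (e -ℤ k) _ _ ⟩
    at (e -ℤ k) (coeffsFrom e a) + at (e -ℤ k) (coeffsFrom e b)
      ≈⟨ +-cong (at-coeffsFrom a (vanishes-above a (ℤ.i≤i⊔j (top a) (top b))) k)
                (at-coeffsFrom b (vanishes-above b (ℤ.i≤j⊔i (top a) (top b))) k) ⟩
    coeff a k + coeff b k                                   ∎
    where open ≈-Reasoning
          e = top a ⊔ℤ top b

  coeff-negK : ∀ a k → coeff (negK a) k ≈ - coeff a k
  coeff-negK a k = trans (coeff-mkK (top a) _ k)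
    (trans (at-neg (top a -ℤ k) (ser a)) (-‿cong (sym (reflexive (coeff≡at a k)))))

  coeff-0K : ∀ k → coeff 0K k ≈ 0#
  coeff-0K k = trans (coeff-mkK (+ 0) 0ₛ k) (at-0ₛ (+ 0 -ℤ k))

  ser-const : ∀ c → ser (const c) ≈ₛ constₛ c
  ser-const c zero    = refl
  ser-const c (suc n) = refl

  conv-suc : ∀ s t n i → conv s t (suc n) (suc i) ≈ s 0 * t (suc n) + conv (tailₛ s) t n i
  conv-suc s t n zero    = +-comm _ _
  conv-suc s t n (suc i) = trans (+-congˡ (conv-suc s t n i)) (x∙yz≈y∙xz _ _ _)

  conv≈*ₛ : ∀ s t n → conv s t n n ≈ (s *ₛ t) n
  conv≈*ₛ s t zero    = refl
  conv≈*ₛ s t (suc n) = trans (conv-suc s t n n) (+-congˡ (conv≈*ₛ (tailₛ s) t n))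

  *K-mkK : ∀ a b → a *K b ≋ mkK (top a +ℤ top b) (ser a *ₛ ser b)
  *K-mkK a b = mkK-cong ≡.refl (conv≈*ₛ (ser a) (ser b))

  mkK-shift : ∀ m e s → mkK (+ m +ℤ e) (shift m s) ≋ mkK e s
  mkK-shift m e s = mk≋ λ k → begin
    coeff (mkK (+ m +ℤ e) (shift m s)) k    ≈⟨ coeff-mkK (+ m +ℤ e) (shift m s) k ⟩
    at ((+ m +ℤ e) -ℤ k) (shift m s)        ≡⟨ ≡.cong (λ i → at i (shift m s)) (ℤ.+-assoc (+ m) e (-ℤ k)) ⟩
    at (+ m +ℤ (e -ℤ k)) (shift m s)        ≈⟨ at-shift m (e -ℤ k) s ⟩
    at (e -ℤ k) s                           ≈⟨ coeff-mkK e s k ⟨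
    coeff (mkK e s) k                       ∎
    where open ≈-Reasoning

  raise : ℕ → K∞ → K∞
  raise m a = mkK (+ m +ℤ top a) (shift m (ser a))

  *K-raiseˡ : ∀ m a b → raise m a *K b ≋ a *K b
  *K-raiseˡ m a b = begin
    raise m a *K b                                          ≈⟨ *K-mkK (raise m a) b ⟩
    mkK ((+ m +ℤ top a) +ℤ top b) (shift m (ser a) *ₛ ser b)
      ≈⟨ mkK-cong (ℤ.+-assoc (+ m) (top a) (top b)) (shift-*ₛ m (ser a) (ser b)) ⟩
    mkK (+ m +ℤ (top a +ℤ top b)) (shift m (ser a *ₛ ser b)) ≈⟨ mkK-shift m _ _ ⟩
    mkK (top a +ℤ top b) (ser a *ₛ ser b)                   ≈⟨ *K-mkK a b ⟨
    a *K b                                                  ∎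
    where open ≋-Reasoning

  -- _*K_ works on representations, so a is first rewritten with the top exponent of a′
  *K-congˡ-≤ : ∀ {a a′} b → top a ≤ℤ top a′ → a ≋ a′ → a *K b ≋ a′ *K b
  *K-congˡ-≤ {a} {a′} b top≤ a≋a′ with i≤j⇒j≡+n+i top≤
  ... | m , top-eq = begin
    a *K b                                     ≈⟨ *K-raiseˡ m a b ⟨
    raise m a *K b                             ≈⟨ *K-mkK (raise m a) b ⟩
    mkK (top (raise m a) +ℤ top b) (ser (raise m a) *ₛ ser b)
      ≈⟨ mkK-cong (≡.cong (_+ℤ top b) (≡.sym top-eq)) (*ₛ-cong same-ser λ _ → refl) ⟩
    mkK (top a′ +ℤ top b) (ser a′ *ₛ ser b)    ≈⟨ *K-mkK a′ b ⟨
    a′ *K b                                    ∎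
    where
      open ≋-Reasoning
      same-ser : ser (raise m a) ≈ₛ ser a′
      same-ser = ser-unique (≡.sym top-eq) (≋-trans (mkK-shift m (top a) (ser a)) a≋a′)

  *K-congˡ : ∀ {a a′} b → a ≋ a′ → a *K b ≋ a′ *K b
  *K-congˡ {a} {a′} b a≋a′ with ℤ.≤-total (top a) (top a′)
  ... | inj₁ top≤ = *K-congˡ-≤ b top≤ a≋a′
  ... | inj₂ top≥ = ≋-sym (*K-congˡ-≤ b top≥ (≋-sym a≋a′))

  *K-comm : ∀ a b → a *K b ≋ b *K a
  *K-comm a b = ≋-trans (*K-mkK a b)
    (≋-trans (mkK-cong (ℤ.+-comm (top a) (top b)) (*ₛ-comm (ser a) (ser b))) (≋-sym (*K-mkK b a)))

  *K-congʳ : ∀ a {b b′} → b ≋ b′ → a *K b ≋ a *K b′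
  *K-congʳ a {b} {b′} b≋b′ = ≋-trans (*K-comm a b) (≋-trans (*K-congˡ a b≋b′) (*K-comm b′ a))

  *K-cong : ∀ {a a′ b b′} → a ≋ a′ → b ≋ b′ → a *K b ≋ a′ *K b′
  *K-cong {a′ = a′} {b} a≋a′ b≋b′ = ≋-trans (*K-congˡ b a≋a′) (*K-congʳ a′ b≋b′)

  *K-assoc : ∀ a b c → (a *K b) *K c ≋ a *K (b *K c)
  *K-assoc a b c = begin
    (a *K b) *K c                                          ≈⟨ *K-mkK (a *K b) c ⟩
    mkK ((top a +ℤ top b) +ℤ top c) (ser (a *K b) *ₛ ser c)
      ≈⟨ mkK-cong (ℤ.+-assoc (top a) (top b) (top c)) ser-assoc ⟩
    mkK (top a +ℤ (top b +ℤ top c)) (ser a *ₛ ser (b *K c)) ≈⟨ *K-mkK a (b *K c) ⟨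
    a *K (b *K c)                                          ∎
    where
      open ≋-Reasoning
      ser-assoc : ser (a *K b) *ₛ ser c ≈ₛ ser a *ₛ ser (b *K c)
      ser-assoc n = trans (*ₛ-cong (conv≈*ₛ (ser a) (ser b)) (λ _ → refl) n)
        (trans (*ₛ-assoc (ser a) (ser b) (ser c) n) (sym (*ₛ-cong (λ _ → refl) (conv≈*ₛ (ser b) (ser c)) n)))

  mkK-+ₛ : ∀ e s t → mkK e (s +ₛ t) ≋ mkK e s +K mkK e t
  mkK-+ₛ e s t = mk≋ λ k → begin
    coeff (mkK e (s +ₛ t)) k                     ≈⟨ coeff-mkK e _ k ⟩
    at (e -ℤ k) (s +ₛ t)                         ≈⟨ at-+ₛ (e -ℤ k) s t ⟩
    at (e -ℤ k) s + at (e -ℤ k) t                ≈⟨ +-cong (coeff-mkK e s k) (coeff-mkK e t k) ⟨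
    coeff (mkK e s) k + coeff (mkK e t) k        ≈⟨ coeff-+K (mkK e s) (mkK e t) k ⟨
    coeff (mkK e s +K mkK e t) k                 ∎
    where open ≈-Reasoning

  +K-cong : ∀ {a a′ b b′} → a ≋ a′ → b ≋ b′ → a +K b ≋ a′ +K b′
  +K-cong {a} {a′} {b} {b′} a≋a′ b≋b′ = mk≋ λ k →
    trans (coeff-+K a b k) (trans (+-cong (coeff≈ a≋a′ k) (coeff≈ b≋b′ k)) (sym (coeff-+K a′ b′ k)))

  *K-distribˡ : ∀ a b c → a *K (b +K c) ≋ (a *K b) +K (a *K c)
  *K-distribˡ a b c = begin
    a *K (b +K c)                                            ≈⟨ *K-mkK a (b +K c) ⟩
    mkK (top a +ℤ e) (ser a *ₛ (coeffsFrom e b +ₛ coeffsFrom e c))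
      ≈⟨ mkK-cong ≡.refl (*ₛ-distribˡ (ser a) _ _) ⟩
    mkK (top a +ℤ e) (ser a *ₛ coeffsFrom e b +ₛ ser a *ₛ coeffsFrom e c)
      ≈⟨ mkK-+ₛ _ _ _ ⟩
    mkK (top a +ℤ e) (ser a *ₛ ser b′) +K mkK (top a +ℤ e) (ser a *ₛ ser c′)
      ≈⟨ +K-cong (*K-mkK a b′) (*K-mkK a c′) ⟨
    (a *K b′) +K (a *K c′)
      ≈⟨ +K-cong (*K-congʳ a (mkK-coeffsFrom b (vanishes-above b (ℤ.i≤i⊔j (top b) (top c)))))
                 (*K-congʳ a (mkK-coeffsFrom c (vanishes-above c (ℤ.i≤j⊔i (top b) (top c))))) ⟩
    (a *K b) +K (a *K c)                                     ∎
    where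
      open ≋-Reasoning
      e  = top b ⊔ℤ top c
      b′ = mkK e (coeffsFrom e b)
      c′ = mkK e (coeffsFrom e c)

  coeff-const-*K : ∀ c a k → coeff (const c *K a) k ≈ c * coeff a k
  coeff-const-*K c a k = begin
    coeff (const c *K a) k                  ≈⟨ coeff≈ (*K-mkK (const c) a) k ⟩
    coeff (mkK (+ 0 +ℤ top a) (ser (const c) *ₛ ser a)) k
      ≈⟨ coeff≈ (mkK-cong (ℤ.+-identityˡ (top a)) const-*ₛ) k ⟩
    coeff (mkK (top a) (c ·ₛ ser a)) k      ≈⟨ coeff-mkK (top a) _ k ⟩
    at (top a -ℤ k) (c ·ₛ ser a)            ≈⟨ at-·ₛ (top a -ℤ k) c (ser a) ⟩
    c * at (top a -ℤ k) (ser a)             ≡⟨ ≡.cong (c *_) (coeff≡at a k) ⟨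
    c * coeff a k                           ∎
    where
      open ≈-Reasoning
      const-*ₛ : ser (const c) *ₛ ser a ≈ₛ c ·ₛ ser a
      const-*ₛ n = trans (*ₛ-cong (ser-const c) (λ _ → refl) n) (constₛ-*ₛ c (ser a) n)

  +K-assoc : ∀ a b c → (a +K b) +K c ≋ a +K (b +K c)
  +K-assoc a b c = mk≋ λ k → begin
    coeff ((a +K b) +K c) k                 ≈⟨ trans (coeff-+K (a +K b) c k) (+-congʳ (coeff-+K a b k)) ⟩
    (coeff a k + coeff b k) + coeff c k     ≈⟨ +-assoc _ _ _ ⟩
    coeff a k + (coeff b k + coeff c k)     ≈⟨ trans (coeff-+K a (b +K c) k) (+-congˡ (coeff-+K b c k)) ⟨
    coeff (a +K (b +K c)) k                 ∎
    where open ≈-Reasoning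

  +K-comm : ∀ a b → a +K b ≋ b +K a
  +K-comm a b = mk≋ λ k → trans (coeff-+K a b k) (trans (+-comm _ _) (sym (coeff-+K b a k)))

  +K-identityˡ : ∀ a → 0K +K a ≋ a
  +K-identityˡ a = mk≋ λ k → trans (coeff-+K 0K a k) (trans (+-congʳ (coeff-0K k)) (+-identityˡ _))

  +K-identityʳ : ∀ a → a +K 0K ≋ a
  +K-identityʳ a = ≋-trans (+K-comm a 0K) (+K-identityˡ a)

  negK-inverseˡ : ∀ a → negK a +K a ≋ 0K
  negK-inverseˡ a = mk≋ λ k → trans (coeff-+K (negK a) a k)
    (trans (+-congʳ (coeff-negK a k)) (trans (-‿inverseˡ _) (sym (coeff-0K k))))

  negK-inverseʳ : ∀ a → a +K negK a ≋ 0K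
  negK-inverseʳ a = ≋-trans (+K-comm a (negK a)) (negK-inverseˡ a)

  negK-cong : ∀ {a a′} → a ≋ a′ → negK a ≋ negK a′
  negK-cong {a} {a′} a≋a′ = mk≋ λ k →
    trans (coeff-negK a k) (trans (-‿cong (coeff≈ a≋a′ k)) (sym (coeff-negK a′ k)))

  *K-identityˡ : ∀ a → const 1# *K a ≋ a
  *K-identityˡ a = mk≋ λ k → trans (coeff-const-*K 1# a k) (*-identityˡ _)

  *K-identityʳ : ∀ a → a *K const 1# ≋ a
  *K-identityʳ a = ≋-trans (*K-comm a (const 1#)) (*K-identityˡ a)

  *K-distribʳ : ∀ a b c → (b +K c) *K a ≋ (b *K a) +K (c *K a)
  *K-distribʳ a b c = ≋-trans (*K-comm (b +K c) a)
    (≋-trans (*K-distribˡ a b c) (+K-cong (*K-comm a b) (*K-comm a c)))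

  K∞-commutativeRing : CommutativeRing 0ℓ 0ℓ
  K∞-commutativeRing = record
    { Carrier = K∞ ; _≈_ = _≋_ ; _+_ = _+K_ ; _*_ = _*K_ ; -_ = negK ; 0# = 0K ; 1# = const 1#
    ; isCommutativeRing = record
      { isRing = record
        { +-isAbelianGroup = record
          { isGroup = record
            { isMonoid = record
              { isSemigroup = record
                { isMagma = record { isEquivalence = Setoid.isEquivalence ≋-setoid ; ∙-cong = +K-cong }
                ; assoc = +K-assoc }
              ; identity = +K-identityˡ , +K-identityʳ }
            ; inverse = negK-inverseˡ , negK-inverseʳ
            ; ⁻¹-cong = negK-cong }
          ; comm = +K-comm }
        ; *-cong = *K-cong
        ; *-assoc = *K-assoc
        ; *-identity = *K-identityˡ , *K-identityʳ
        ; distrib = *K-distribˡ , *K-distribʳ }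
      ; *-comm = *K-comm } }

  module _ (Z : ℤ → Set) where

    vanishes-0K : VanishesOn Z 0K
    vanishes-0K k _ = coeff-0K k

    vanishes-+K : ∀ a b → VanishesOn Z a → VanishesOn Z b → VanishesOn Z (a +K b)
    vanishes-+K a b a₀ b₀ k k∈Z =
      trans (coeff-+K a b k) (trans (+-cong (a₀ k k∈Z) (b₀ k k∈Z)) (+-identityˡ 0#))

    vanishes-negK : ∀ a → VanishesOn Z a → VanishesOn Z (negK a)
    vanishes-negK a a₀ k k∈Z = trans (coeff-negK a k) (trans (-‿cong (a₀ k k∈Z)) -0#≈0#)

    vanishes-const-*K : ∀ c a → VanishesOn Z a → VanishesOn Z (const c *K a)
    vanishes-const-*K c a a₀ k k∈Z = trans (coeff-const-*K c a k) (trans (*-congˡ (a₀ k k∈Z)) (zeroʳ c))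

module FractionalPart {q : ℕ} (F : FiniteField q) where
  open FiniteField F
  open LaurentOver F
  open LaurentSeriesRing F
  open import Algebra.Properties.Group (CommutativeRing.+-group K∞-commutativeRing) using (\\-leftDividesˡ)

  fracPart : K∞ → K∞
  fracPart a = mkK -[1+ 0 ] (λ n → coeff a -[1+ n ])

  polyPart : K∞ → K∞
  polyPart a = negK (fracPart a) +K a

  fracPart-InM : ∀ a → InM (fracPart a)
  fracPart-InM a (+ 0)     _ = coeff-mkK -[1+ 0 ] (ser (fracPart a)) (+ 0)
  fracPart-InM a (+ suc n) _ = coeff-mkK -[1+ 0 ] (ser (fracPart a)) (+ suc n)

  coeff-fracPart-<0 : ∀ a n → coeff (fracPart a) -[1+ n ] ≈ coeff a -[1+ n ]
  coeff-fracPart-<0 a n = coeff-mkK -[1+ 0 ] (ser (fracPart a)) -[1+ n ]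

  polyPart-IsPoly : ∀ a → IsPoly (polyPart a)
  polyPart-IsPoly a (+ _)    (+<+ ())
  polyPart-IsPoly a -[1+ n ] _ = begin
    coeff (negK (fracPart a) +K a) -[1+ n ]  ≈⟨ coeff-+K (negK (fracPart a)) a -[1+ n ] ⟩
    coeff (negK (fracPart a)) -[1+ n ] + coeff a -[1+ n ]
      ≈⟨ +-congʳ (trans (coeff-negK (fracPart a) -[1+ n ]) (-‿cong (coeff-fracPart-<0 a n))) ⟩
    - coeff a -[1+ n ] + coeff a -[1+ n ]                    ≈⟨ -‿inverseˡ _ ⟩
    0#                                                       ∎
    where open ≈-Reasoning

  fracPart+polyPart : ∀ a → fracPart a +K polyPart a ≋ a
  fracPart+polyPart a = \\-leftDividesˡ (fracPart a) a

  fracPart-unique : ∀ {a m p} → InM m → IsPoly p → a ≋ m +K p → fracPart a ≋ m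
  fracPart-unique {a} {m} {p} m∈𝔪 p∈R a≋m+p = mk≋ coeffs
    where
      coeffs : ∀ k → coeff (fracPart a) k ≈ coeff m k
      coeffs (+ n)    = trans (fracPart-InM a (+ n) (+≤+ ℕ.z≤n)) (sym (m∈𝔪 (+ n) (+≤+ ℕ.z≤n)))
      coeffs -[1+ n ] = begin
        coeff (fracPart a) -[1+ n ]             ≈⟨ coeff-fracPart-<0 a n ⟩
        coeff a -[1+ n ]                        ≈⟨ coeff≈ a≋m+p -[1+ n ] ⟩
        coeff (m +K p) -[1+ n ]                 ≈⟨ coeff-+K m p -[1+ n ] ⟩
        coeff m -[1+ n ] + coeff p -[1+ n ]     ≈⟨ +-congˡ (p∈R -[1+ n ] -<+) ⟩
        coeff m -[1+ n ] + 0#                   ≈⟨ +-identityʳ _ ⟩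
        coeff m -[1+ n ]                        ∎
        where open ≈-Reasoning

module Polynomials {q : ℕ} (F : FiniteField q) (N : ℕ) where
  open FiniteField F
  open LaurentOver F
  open PowerSeries commRing
  open LaurentSeriesRing F
  open IntegerLemmas
  open import Data.Fin.Properties using (finToFun-funToFin; funToFin-finToFin)
  open import Data.Nat.Properties using (m<m+n)

  digits : Fin (q ℕ.^ suc N) → Fin (suc N) → Fin q
  digits = Fin.finToFun

  fromDigits : (Fin (suc N) → Fin q) → Fin (q ℕ.^ suc N)
  fromDigits = Fin.funToFin

  -- the digits of i, read through enum, are the coefficients of x^N, x^(N-1), …, x^0
  poly : Fin (q ℕ.^ suc N) → K∞
  poly i = mkK (+ N) (padded (enum ∘ digits i))

  poly-IsPoly : ∀ i → IsPoly (poly i)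
  poly-IsPoly i (+ _)    (+<+ ())
  poly-IsPoly i -[1+ j ] _ =
    trans (coeff-mkK (+ N) (ser (poly i)) -[1+ j ]) (padded-≥ (enum ∘ digits i) (m<m+n N ℕ.z<s))

  poly-DegLe : ∀ i → DegLe N (poly i)
  poly-DegLe i = vanishes-above-top (poly i)

  poly-injective : ∀ i j → poly i ≋ poly j → i ≡ j
  poly-injective i j pᵢ≋pⱼ = begin
    i                        ≡⟨ funToFin-finToFin {suc N} {q} i ⟨
    fromDigits (digits i)    ≡⟨ funToFin-cong same-digits ⟩
    fromDigits (digits j)    ≡⟨ funToFin-finToFin {suc N} {q} j ⟩
    j                        ∎
    where
      open ≡.≡-Reasoning
      same-digits : ∀ x → digits i x ≡ digits j x
      same-digits x = enum-inj _ _ (trans (reflexive (≡.sym (padded-toℕ (enum ∘ digits i) x)))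
        (trans (ser-unique ≡.refl pᵢ≋pⱼ (Fin.toℕ x)) (reflexive (padded-toℕ (enum ∘ digits j) x))))

  poly-surjective : ∀ Q → IsPoly Q → DegLe N Q → Σ (Fin (q ℕ.^ suc N)) λ i → Q ≋ poly i
  poly-surjective Q Q∈R deg≤N = i , (begin
    Q
      ≈⟨ mkK-coeffsFrom Q deg≤N ⟨
    mkK (+ N) (coeffsFrom (+ N) Q)
      ≈⟨ mkK-cong ≡.refl (padded-restrict (suc N) (coeffsFrom (+ N) Q) below-0) ⟩
    mkK (+ N) (padded {suc N} (coeffsFrom (+ N) Q ∘ Fin.toℕ))
      ≈⟨ mkK-cong ≡.refl (padded-cong {suc N} digit) ⟩
    poly i
      ∎)
    where
      open ≋-Reasoning
      c : Fin (suc N) → Fin q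
      c x = proj₁ (enum-sur (coeffsFrom (+ N) Q (Fin.toℕ x)))
      i = fromDigits c
      below-0 : ∀ m → suc N ℕ.≤ m → coeffsFrom (+ N) Q m ≈ 0#
      below-0 m N<m = Q∈R _ (i<j⇒i-j<0 (+<+ N<m))
      digit : ∀ x → coeffsFrom (+ N) Q (Fin.toℕ x) ≈ enum (digits i x)
      digit x = trans (proj₂ (enum-sur _)) (reflexive (≡.cong enum (≡.sym (finToFun-funToFin {suc N} {q} c x))))

module Matrices {q : ℕ} (F : FiniteField q) where
  open FiniteField F using (1#)
  open LaurentOver F
  open LaurentSeriesRing F
  module K = CommutativeRing K∞-commutativeRing
  open import Algebra.Properties.Semiring.Sum K.semiring
    using (sum; sum-cong-≋; ∑-comm; ∑-distrib-+; *-distribˡ-sum; *-distribʳ-sum; sum-replicate-zero; sum-remove)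
  open import Algebra.Properties.Group K.+-group using (inverseˡ-unique)
  open import Algebra.Properties.CommutativeSemigroup K.*-commutativeSemigroup using (x∙yz≈y∙xz)
  open import Data.Fin.Properties using (punchInᵢ≢i)
  open import Relation.Nullary using (yes; no; ¬_)
  open import Data.Empty using (⊥-elim)
  module KR = SetoidReasoning K.setoid

  infix 4 _≋V_
  _≋V_ : ∀ {d} → Vec d → Vec d → Set
  u ≋V v = ∀ i → u i ≋ v i

  ≋V⇒≈V : ∀ {d} {u v : Vec d} → u ≋V v → u ≈V v
  ≋V⇒≈V u≋v i = coeff≈ (u≋v i)

  negV : ∀ {d} → Vec d → Vec d
  negV v i = negK (v i)

  sumK≡sum : ∀ {d} (f : Fin d → K∞) → sumK f ≡ sum f
  sumK≡sum {zero}  f = ≡.refl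
  sumK≡sum {suc d} f = ≡.cong (f Fin.zero +K_) (sumK≡sum (f ∘ Fin.suc))

  ·≈sum : ∀ {d} (g : Mat d) v i → (g · v) i ≋ sum (λ j → g i j *K v j)
  ·≈sum g v i = K.reflexive (sumK≡sum _)

  ·-cong : ∀ {d} (g : Mat d) {u v} → u ≋V v → g · u ≋V g · v
  ·-cong g {u} {v} u≋v i = begin
    (g · u) i                   ≈⟨ ·≈sum g u i ⟩
    sum (λ j → g i j *K u j)    ≈⟨ sum-cong-≋ (λ j → K.*-congˡ {g i j} (u≋v j)) ⟩
    sum (λ j → g i j *K v j)    ≈⟨ ·≈sum g v i ⟨
    (g · v) i                   ∎
    where open KR

  ·-+V : ∀ {d} (g : Mat d) u v → g · (u +V v) ≋V (g · u) +V (g · v)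
  ·-+V g u v i = begin
    (g · (u +V v)) i                                      ≈⟨ ·≈sum g (u +V v) i ⟩
    sum (λ j → g i j *K (u j +K v j))                     ≈⟨ sum-cong-≋ (λ j → K.distribˡ (g i j) (u j) (v j)) ⟩
    sum (λ j → (g i j *K u j) +K (g i j *K v j))          ≈⟨ ∑-distrib-+ (λ j → g i j *K u j) (λ j → g i j *K v j) ⟩
    sum (λ j → g i j *K u j) +K sum (λ j → g i j *K v j)  ≈⟨ K.+-cong (·≈sum g u i) (·≈sum g v i) ⟨
    ((g · u) +V (g · v)) i                                ∎
    where open KR

  ·-*V : ∀ {d} (g : Mat d) c v → g · (c *V v) ≋V c *V (g · v)
  ·-*V g c v i = begin
    (g · (c *V v)) i                    ≈⟨ ·≈sum g (c *V v) i ⟩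
    sum (λ j → g i j *K (c *K v j))     ≈⟨ sum-cong-≋ (λ j → x∙yz≈y∙xz (g i j) c (v j)) ⟩
    sum (λ j → c *K (g i j *K v j))     ≈⟨ *-distribˡ-sum c (λ j → g i j *K v j) ⟨
    c *K sum (λ j → g i j *K v j)       ≈⟨ K.*-congˡ {c} (·≈sum g v i) ⟨
    (c *V (g · v)) i                    ∎
    where open KR

  ·-0V : ∀ {d} (g : Mat d) → g · 0V ≋V 0V
  ·-0V {d} g i = K.trans (·≈sum g 0V i)
    (K.trans (sum-cong-≋ (λ j → K.zeroʳ (g i j))) (sum-replicate-zero d))

  ·-negV : ∀ {d} (g : Mat d) v → g · negV v ≋V negV (g · v)
  ·-negV g v i = inverseˡ-unique ((g · negV v) i) ((g · v) i) (begin
    (g · negV v) i +K (g · v) i    ≈⟨ ·-+V g (negV v) v i ⟨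
    (g · (negV v +V v)) i          ≈⟨ ·-cong g (λ j → K.-‿inverseˡ (v j)) i ⟩
    (g · 0V) i                     ≈⟨ ·-0V g i ⟩
    0K                             ∎)
    where open KR

  ·-assoc : ∀ {d} (g h : Mat d) v → g · (h · v) ≋V (g ⊗ h) · v
  ·-assoc g h v i = begin
    (g · (h · v)) i
      ≈⟨ ·≈sum g (h · v) i ⟩
    sum (λ j → g i j *K (h · v) j)
      ≈⟨ sum-cong-≋ (λ j → K.*-congˡ {g i j} (·≈sum h v j)) ⟩
    sum (λ j → g i j *K sum (λ k → h j k *K v k))
      ≈⟨ sum-cong-≋ (λ j → *-distribˡ-sum (g i j) (λ k → h j k *K v k)) ⟩
    sum (λ j → sum (λ k → g i j *K (h j k *K v k)))
      ≈⟨ sum-cong-≋ (λ j → sum-cong-≋ (λ k → K.*-assoc (g i j) (h j k) (v k))) ⟨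
    sum (λ j → sum (λ k → (g i j *K h j k) *K v k))
      ≈⟨ ∑-comm (λ j k → (g i j *K h j k) *K v k) ⟩
    sum (λ k → sum (λ j → (g i j *K h j k) *K v k))
      ≈⟨ sum-cong-≋ (λ k → *-distribʳ-sum (v k) (λ j → g i j *K h j k)) ⟨
    sum (λ k → sum (λ j → g i j *K h j k) *K v k)
      ≈⟨ sum-cong-≋ (λ k → K.*-congʳ {v k} (K.reflexive (sumK≡sum (λ j → g i j *K h j k)))) ⟨
    sum (λ k → (g ⊗ h) i k *K v k)
      ≈⟨ ·≈sum (g ⊗ h) v i ⟨
    ((g ⊗ h) · v) i
      ∎
    where open KR

  idMat-diag : ∀ {d} (i : Fin d) → idMat i i ≋ const 1#
  idMat-diag i with i Fin.≟ i
  ... | yes _  = K.refl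
  ... | no i≢i = ⊥-elim (i≢i ≡.refl)

  idMat-off : ∀ {d} (i j : Fin d) → ¬ i ≡ j → idMat i j ≋ 0K
  idMat-off i j i≢j with i Fin.≟ j
  ... | yes i≡j = ⊥-elim (i≢j i≡j)
  ... | no _    = K.refl

  ·-identity : ∀ {d} v → idMat {d} · v ≋V v
  ·-identity {suc d} v i = begin
    (idMat · v) i                                          ≈⟨ ·≈sum idMat v i ⟩
    sum t                                                  ≈⟨ sum-remove t ⟩
    t i +K sum (λ j → t (Fin.punchIn i j))
      ≈⟨ K.+-cong (K.trans (K.*-congʳ (idMat-diag i)) (K.*-identityˡ (v i)))
                  (K.trans (sum-cong-≋ off-diagonal) (sum-replicate-zero d)) ⟩
    v i +K 0K                                              ≈⟨ K.+-identityʳ (v i) ⟩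
    v i                                                    ∎
    where
      open KR
      t : Fin (suc d) → K∞
      t j = idMat i j *K v j
      off-diagonal : ∀ j → t (Fin.punchIn i j) ≋ 0K
      off-diagonal j = K.trans (K.*-congʳ {v (Fin.punchIn i j)} (idMat-off i _ (punchInᵢ≢i i j ∘ ≡.sym)))
                               (K.zeroˡ (v (Fin.punchIn i j)))

  ·-congˡ : ∀ {d} (g g′ : Mat d) → g ≈M g′ → ∀ v → g · v ≋V g′ · v
  ·-congˡ g g′ g≈g′ v i = begin
    (g · v) i                    ≈⟨ ·≈sum g v i ⟩
    sum (λ j → g i j *K v j)     ≈⟨ sum-cong-≋ (λ j → K.*-congʳ {v j} {g i j} {g′ i j} (mk≋ (g≈g′ i j))) ⟩
    sum (λ j → g′ i j *K v j)    ≈⟨ ·≈sum g′ v i ⟨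
    (g′ · v) i                   ∎
    where open KR

  ·-inverse : ∀ {d} (g h : Mat d) → (g ⊗ h) ≈M idMat → ∀ v → g · (h · v) ≋V v
  ·-inverse g h gh≈id v i =
    K.trans (·-assoc g h v i) (K.trans (·-congˡ (g ⊗ h) idMat gh≈id v i) (·-identity v i))

module PeriodicLattices {q : ℕ} (F : FiniteField q) {d : ℕ} (g : LaurentOver.Mat F d) where
  open LaurentOver F
  open LaurentSeriesRing F
  open Matrices F
  open import Algebra.Properties.CommutativeSemigroup K.+-commutativeSemigroup using (interchange; x∙yz≈y∙xz)

  -- InLattice and InD of Defs are InImage (_< 0) and InImage (0 ≤_), up to ≈V versus ≋V
  InImage : (ℤ → Set) → Subset d
  InImage Z v = Σ (Vec d) λ P → (∀ i → VanishesOn Z (P i)) × v ≋V g · P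

  module _ {Z : ℤ → Set} where

    image-cong : ∀ {u v} → u ≋V v → InImage Z u → InImage Z v
    image-cong u≋v (P , P₀ , u≋gP) = P , P₀ , λ i → K.trans (K.sym (u≋v i)) (u≋gP i)

    image-0V : InImage Z 0V
    image-0V = 0V , (λ _ → vanishes-0K Z) , λ i → K.sym (·-0V g i)

    image-+V : ∀ {u v} → InImage Z u → InImage Z v → InImage Z (u +V v)
    image-+V (P , P₀ , u≋gP) (P′ , P′₀ , v≋gP′) =
      P +V P′ , (λ i → vanishes-+K Z (P i) (P′ i) (P₀ i) (P′₀ i)) ,
      λ i → K.trans (K.+-cong (u≋gP i) (v≋gP′ i)) (K.sym (·-+V g P P′ i))

    image-negV : ∀ {v} → InImage Z v → InImage Z (negV v)
    image-negV (P , P₀ , v≋gP) =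
      negV P , (λ i → vanishes-negK Z (P i) (P₀ i)) ,
      λ i → K.trans (K.-‿cong (v≋gP i)) (K.sym (·-negV g P i))

    image-*V : ∀ c {v} → InImage Z v → InImage Z (const c *V v)
    image-*V c (P , P₀ , v≋gP) =
      const c *V P , (λ i → vanishes-const-*K Z c (P i) (P₀ i)) ,
      λ i → K.trans (K.*-congˡ {const c} (v≋gP i)) (K.sym (·-*V g (const c) P i))

  InΛ In𝒟 : Subset d
  InΛ = InImage (_<ℤ 0ℤ)
  In𝒟 = InImage (0ℤ ≤ℤ_)

  InLattice⇒InΛ : ∀ {v} → InLattice g v → InΛ v
  InLattice⇒InΛ (P , P∈R , v≈gP) = P , P∈R , λ i → mk≋ (v≈gP i)

  InΛ⇒InLattice : ∀ {v} → InΛ v → InLattice g v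
  InΛ⇒InLattice (P , P∈R , v≋gP) = P , P∈R , ≋V⇒≈V v≋gP

  InD⇒In𝒟 : ∀ {v} → InD g v → In𝒟 v
  InD⇒In𝒟 (P , P∈𝔪 , v≈gP) = P , P∈𝔪 , λ i → mk≋ (v≈gP i)

  In𝒟⇒InD : ∀ {v} → In𝒟 v → InD g v
  In𝒟⇒InD (P , P∈𝔪 , v≋gP) = P , P∈𝔪 , ≋V⇒≈V v≋gP

  module Translates (α : Vec d) (N : ℕ) where

    InΛα : Subset d
    InΛα v = Σ K∞ λ Q → IsPoly Q × DegLe N Q × Σ (Vec d) λ l → InΛ l × v ≋V (Q *V α) +V l

    InLatticeAlpha⇒InΛα : ∀ {v} → InLatticeAlpha g α N v → InΛα v
    InLatticeAlpha⇒InΛα (Q , Q∈R , Q≤N , l , l∈Λ , v≈Qα+l) =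
      Q , Q∈R , Q≤N , l , InLattice⇒InΛ l∈Λ , λ i → mk≋ (v≈Qα+l i)

    InΛα⇒InLatticeAlpha : ∀ {v} → InΛα v → InLatticeAlpha g α N v
    InΛα⇒InLatticeAlpha (Q , Q∈R , Q≤N , l , l∈Λ , v≋Qα+l) =
      Q , Q∈R , Q≤N , l , InΛ⇒InLattice l∈Λ , ≋V⇒≈V v≋Qα+l

    Λα-cong : ∀ {u v} → u ≋V v → InΛα u → InΛα v
    Λα-cong u≋v (Q , Q∈R , Q≤N , l , l∈Λ , u≋Qα+l) =
      Q , Q∈R , Q≤N , l , l∈Λ , λ i → K.trans (K.sym (u≋v i)) (u≋Qα+l i)

    Λα-0V : InΛα 0V
    Λα-0V = 0K , vanishes-0K _ , vanishes-0K _ , 0V , image-0V ,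
      λ i → K.sym (K.trans (K.+-identityʳ (0K *K α i)) (K.zeroˡ (α i)))

    Λα-+V : ∀ {u v} → InΛα u → InΛα v → InΛα (u +V v)
    Λα-+V {u} {v} (Q₁ , Q₁∈R , Q₁≤N , l₁ , l₁∈Λ , u≋) (Q₂ , Q₂∈R , Q₂≤N , l₂ , l₂∈Λ , v≋) =
      Q₁ +K Q₂ , vanishes-+K _ Q₁ Q₂ Q₁∈R Q₂∈R , vanishes-+K _ Q₁ Q₂ Q₁≤N Q₂≤N ,
      l₁ +V l₂ , image-+V l₁∈Λ l₂∈Λ , sum-form
      where
        sum-form : u +V v ≋V ((Q₁ +K Q₂) *V α) +V (l₁ +V l₂)
        sum-form i = begin
          u i +K v i                                         ≈⟨ K.+-cong (u≋ i) (v≋ i) ⟩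
          ((Q₁ *K α i) +K l₁ i) +K ((Q₂ *K α i) +K l₂ i)
            ≈⟨ interchange (Q₁ *K α i) (l₁ i) (Q₂ *K α i) (l₂ i) ⟩
          ((Q₁ *K α i) +K (Q₂ *K α i)) +K (l₁ i +K l₂ i)
            ≈⟨ K.+-congʳ {l₁ i +K l₂ i} (K.distribʳ (α i) Q₁ Q₂) ⟨
          ((Q₁ +K Q₂) *K α i) +K (l₁ i +K l₂ i)              ∎
          where open KR

    Λα-*V : ∀ c {v} → InΛα v → InΛα (const c *V v)
    Λα-*V c {v} (Q , Q∈R , Q≤N , l , l∈Λ , v≋) =
      const c *K Q , vanishes-const-*K _ c Q Q∈R , vanishes-const-*K _ c Q Q≤N ,
      const c *V l , image-*V c l∈Λ , scaled-form
      where
        scaled-form : const c *V v ≋V ((const c *K Q) *V α) +V (const c *V l)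
        scaled-form i = begin
          const c *K v i                                     ≈⟨ K.*-congˡ {const c} (v≋ i) ⟩
          const c *K ((Q *K α i) +K l i)                     ≈⟨ K.distribˡ (const c) (Q *K α i) (l i) ⟩
          (const c *K (Q *K α i)) +K (const c *K l i)
            ≈⟨ K.+-congʳ {const c *K l i} (K.*-assoc (const c) Q (α i)) ⟨
          ((const c *K Q) *K α i) +K (const c *K l i)        ∎
          where open KR

    Λ+Λα⊆Λα : ∀ {l s} → InΛ l → InΛα s → InΛα (l +V s)
    Λ+Λα⊆Λα {l} {s} l∈Λ (Q , Q∈R , Q≤N , l′ , l′∈Λ , s≋) =
      Q , Q∈R , Q≤N , l +V l′ , image-+V l∈Λ l′∈Λ ,
      λ i → K.trans (K.+-congˡ {l i} (s≋ i)) (x∙yz≈y∙xz (l i) (Q *K α i) (l′ i))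

    Λα-isFqSubspace : IsFqSubspace (InLatticeAlpha g α N)
    Λα-isFqSubspace =
      InΛα⇒InLatticeAlpha Λα-0V ,
      (λ u v u∈ v∈ →
        InΛα⇒InLatticeAlpha (Λα-+V (InLatticeAlpha⇒InΛα {u} u∈) (InLatticeAlpha⇒InΛα {v} v∈))) ,
      (λ c v v∈ → InΛα⇒InLatticeAlpha (Λα-*V c (InLatticeAlpha⇒InΛα {v} v∈)))

    Λ+Λα≡Λα : LatticePlusEq g (InLatticeAlpha g α N)
    Λ+Λα≡Λα v = sum⇒member , member⇒sum
      where
        Sum : Set
        Sum = Σ (Vec d) λ l → Σ (Vec d) λ s → InLattice g l × InLatticeAlpha g α N s × v ≈V (l +V s)

        sum⇒member : Sum → InLatticeAlpha g α N v
        sum⇒member (l , s , l∈Λ , s∈Λα , v≈l+s) = InΛα⇒InLatticeAlpha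
          (Λα-cong (λ i → K.sym (mk≋ {v i} {(l +V s) i} (v≈l+s i)))
                   (Λ+Λα⊆Λα (InLattice⇒InΛ {l} l∈Λ) (InLatticeAlpha⇒InΛα {s} s∈Λα)))

        member⇒sum : InLatticeAlpha g α N v → Sum
        member⇒sum v∈Λα = 0V , v , InΛ⇒InLattice image-0V , v∈Λα , λ i → coeff≈ (K.sym (K.+-identityˡ (v i)))

  module Reduction (g-invertible : IsInvertible g) where
    open FractionalPart F

    h : Mat d
    h = proj₁ g-invertible

    fracV polyV : Vec d → Vec d
    fracV v i = fracPart (v i)
    polyV v i = polyPart (v i)

    reduce : Vec d → Vec d
    reduce v = g · fracV (h · v)

    reduce-∈𝒟 : ∀ v → In𝒟 (reduce v)
    reduce-∈𝒟 v = fracV (h · v) , (λ i → fracPart-InM ((h · v) i)) , λ i → K.refl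

    reduce-decomposition : ∀ v → Σ (Vec d) λ l → InΛ l × v ≋V reduce v +V l
    reduce-decomposition v =
      g · polyV (h · v) , (polyV (h · v) , (λ i → polyPart-IsPoly ((h · v) i)) , λ i → K.refl) , split
      where
        split : v ≋V reduce v +V (g · polyV (h · v))
        split i = begin
          v i                                       ≈⟨ ·-inverse g h (proj₁ (proj₂ g-invertible)) v i ⟨
          (g · (h · v)) i                           ≈⟨ ·-cong g (λ j → fracPart+polyPart ((h · v) j)) i ⟨
          (g · (fracV (h · v) +V polyV (h · v))) i  ≈⟨ ·-+V g (fracV (h · v)) (polyV (h · v)) i ⟩
          (reduce v +V (g · polyV (h · v))) i       ∎
          where open KR

    reduce-unique : ∀ {v w l} → In𝒟 w → InΛ l → v ≋V w +V l → reduce v ≋V w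
    reduce-unique {v} {w} {l} (M , M∈𝔪 , w≋gM) (P , P∈R , l≋gP) v≋w+l i = begin
      (g · fracV (h · v)) i   ≈⟨ ·-cong g (λ j → fracPart-unique (M∈𝔪 j) (P∈R j) (hv≋M+P j)) i ⟩
      (g · M) i               ≈⟨ w≋gM i ⟨
      w i                     ∎
      where
        open KR
        hv≋M+P : h · v ≋V M +V P
        hv≋M+P j = begin
          (h · v) j                   ≈⟨ ·-cong h v≋w+l j ⟩
          (h · (w +V l)) j            ≈⟨ ·-cong h (λ k → K.+-cong (w≋gM k) (l≋gP k)) j ⟩
          (h · ((g · M) +V (g · P))) j ≈⟨ ·-cong h (·-+V g M P) j ⟨
          (h · (g · (M +V P))) j      ≈⟨ ·-inverse h g (proj₂ (proj₂ g-invertible)) (M +V P) j ⟩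
          (M +V P) j                  ∎

  module Cardinality (g-invertible : IsInvertible g) (α : Vec d) (N : ℕ) (irrational : NIrrational g N α) where
    open Reduction g-invertible
    open Translates α N
    open Polynomials F N
    open AbelianGroupLemmas K.+-abelianGroup
    open import Algebra.Properties.Group K.+-group using (x∙y⁻¹≈ε⇒x≈y)
    open import Algebra.Properties.Ring K.ring using ([y-z]x≈yx-zx)
    open import Relation.Nullary using (yes; no; ¬_)
    open import Data.Empty using (⊥-elim)

    representative : Fin (q ℕ.^ suc N) → Vec d
    representative i = reduce (poly i *V α)

    representative-∈Λα : ∀ i → InΛα (representative i)
    representative-∈Λα i with reduce-decomposition (poly i *V α)
    ... | l , l∈Λ , Qα≋p+l = poly i , poly-IsPoly i , poly-DegLe i , negV l , image-negV l∈Λ ,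
      λ j → K.sym (x≈y∙z⇒x∙z⁻¹≈y (poly i *K α j) (representative i j) (l j) (Qα≋p+l j))

    representative-injective : ∀ i j → representative i ≈V representative j → i ≡ j
    representative-injective i j rᵢ≈rⱼ with i Fin.≟ j
    ... | yes i≡j = i≡j
    ... | no i≢j with reduce-decomposition (poly i *V α) | reduce-decomposition (poly j *V α)
    ...   | lᵢ , lᵢ∈Λ , Qᵢα≋ | lⱼ , lⱼ∈Λ , Qⱼα≋ =
      ⊥-elim (irrational (Q , Q∈R , Q≤N , Q≉0 ,
        InΛ⇒InLattice (image-cong Qα≋ (image-+V lᵢ∈Λ (image-negV lⱼ∈Λ)))))
      where
        Q : K∞
        Q = poly i +K negK (poly j)
        Q∈R : IsPoly Q
        Q∈R = vanishes-+K _ (poly i) (negK (poly j)) (poly-IsPoly i) (vanishes-negK _ (poly j) (poly-IsPoly j))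
        Q≤N : DegLe N Q
        Q≤N = vanishes-+K _ (poly i) (negK (poly j)) (poly-DegLe i) (vanishes-negK _ (poly j) (poly-DegLe j))
        Q≉0 : ¬ Q ≈K 0K
        Q≉0 Q≈0 = i≢j (poly-injective i j (x∙y⁻¹≈ε⇒x≈y (poly i) (poly j) (mk≋ Q≈0)))
        Qα≋ : lᵢ +V negV lⱼ ≋V Q *V α
        Qα≋ k = begin
          lᵢ k +K negK (lⱼ k)
            ≈⟨ zx∙[zy]⁻¹≈x∙y⁻¹ (lᵢ k) (lⱼ k) (representative i k) ⟨
          (representative i k +K lᵢ k) +K negK (representative i k +K lⱼ k)
            ≈⟨ K.+-cong (K.sym (Qᵢα≋ k))
                        (K.-‿cong (K.trans (K.+-congʳ {lⱼ k} (mk≋ (rᵢ≈rⱼ k))) (K.sym (Qⱼα≋ k)))) ⟩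
          (poly i *K α k) +K negK (poly j *K α k)
            ≈⟨ [y-z]x≈yx-zx (α k) (poly i) (poly j) ⟨
          Q *K α k
            ∎
          where open KR

    representative-surjective : ∀ v → (InD g ∩ InLatticeAlpha g α N) v →
                                Σ (Fin (q ℕ.^ suc N)) λ i → v ≈V representative i
    representative-surjective v (v∈D , v∈Λα) with InLatticeAlpha⇒InΛα {v} v∈Λα
    ... | Q , Q∈R , Q≤N , l , l∈Λ , v≋Qα+l with poly-surjective Q Q∈R Q≤N
    ...   | i , Q≋pᵢ =
      i , ≋V⇒≈V (λ k → K.sym (reduce-unique (InD⇒In𝒟 {v} v∈D) (image-negV l∈Λ) pᵢα≋v-l k))
      where
        pᵢα≋v-l : poly i *V α ≋V v +V negV l
        pᵢα≋v-l k = K.trans (K.*-congʳ {α k} (K.sym Q≋pᵢ))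
          (K.sym (x≈y∙z⇒x∙z⁻¹≈y (v k) (Q *K α k) (l k) (v≋Qα+l k)))

    D∩Λα-card : HasCard (InD g ∩ InLatticeAlpha g α N) (q ℕ.^ suc N)
    D∩Λα-card =
      representative ,
      (λ i → In𝒟⇒InD (reduce-∈𝒟 _) , InΛα⇒InLatticeAlpha (representative-∈Λα i)) ,
      representative-injective ,
      representative-surjective

open import Data.Nat using (_≤_; _^_; _+_)
open import Data.Nat.Properties using (+-comm)

lemma2p1 : (q : ℕ) (F : FiniteField q) (d : ℕ) → 2 ≤ d →
    let open LaurentOver F in
    (g : Mat d) → IsInvertible g → (N : ℕ) → (α : Vec d) → NIrrational g N α →
    HasCard (InD g ∩ InLatticeAlpha g α N) (q ^ (N + 1))
      × IsPeriodicLattice g (N + 1) (InLatticeAlpha g α N)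
lemma2p1 q F d _ g g-invertible N α irrational = card , Λα-isFqSubspace , Λ+Λα≡Λα , card
  where
    open LaurentOver F
    open PeriodicLattices F g
    open Translates α N
    open Cardinality g-invertible α N irrational
    card : HasCard (InD g ∩ InLatticeAlpha g α N) (q ^ (N + 1))
    card = ≡.subst (λ n → HasCard (InD g ∩ InLatticeAlpha g α N) (q ^ n)) (+-comm 1 N) D∩Λα-card
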